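{- Let $s$ be a fully normalized binary string of length $n\ge 7$. Then there is a restricted prefix block-interchange applicable to $s$ that is a $4$-pblockInterchange, i.e. after applying it and normalizing, the resulting string has length $n-4$.
   Context: A binary string is $s=s[1]\ldots s[n]$ with each $s[i]\in\{0,1\}$. A string is normalized if no two adjacent symbols are equal; normalizing means replacing every maximal run of identical adjacent symbols by a single copy. A fully normalized binary string is a normalized string over $\{0,1\}$ in which both $0$ and $1$ occur. The block-interchange $\beta(w,x,y,z)$, $1\le w\le x<y\le z\le n$, transforms $s$ into $s[1]\ldots s[w-1]\,s[y]\ldots s[z]\,s[x+1]\ldots s[y-1]\,s[w]\ldots s[x]\,s[z+1]\ldots s[n]$. A restricted prefix block-interchange is an operation of the form $\beta(2,2,y,z)$ with $3\le y\le z\le n$ (the first symbol stays fixed, and the symbol $s[2]$ is exchanged with the block $s[y..z]$). An operation applied to a normalized string of length $n$ is an $l$-pblockInterchange if the normalized form of the result has length $n-l$. -}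

module Defs where

open import Data.Bool using (Bool; true; false; _∧_; not)
open import Data.Bool.Properties using () renaming (_≟_ to _≟ᵇ_)
open import Data.Nat using (ℕ; zero; suc; _+_; _∸_; _≤_; _<_)
open import Data.List using (List; []; _∷_; _++_; take; drop; length)
open import Data.List.Membership.Propositional using (_∈_)
open import Data.Product using (_×_; ∃-syntax)
open import Relation.Binary.PropositionalEquality using (_≡_; _≢_)
open import Relation.Nullary using (yes; no)

-- Binary strings: lists of booleans; s[i] (1-based) is the i-th element.
BinString : Set
BinString = List Bool

-- Substring s[i..j] (1-based, inclusive); empty when j < i.
sub : BinString → ℕ → ℕ → BinString
sub s i j = take (suc j ∸ i) (drop (i ∸ 1) s)

data Normalized : BinString → Set where
  norm-[]  : Normalized []
  norm-[_] : ∀ b → Normalized (b ∷ [])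
  norm-∷   : ∀ {a b s} → a ≢ b → Normalized (b ∷ s) → Normalized (a ∷ b ∷ s)

-- Fully normalized: normalized, and both 0 (false) and 1 (true) occur.
FullyNormalized : BinString → Set
FullyNormalized s = Normalized s × (false ∈ s) × (true ∈ s)

-- Normalization: replace each maximal run of equal adjacent symbols by one copy.
-- normFrom a s : normalization of (a ∷ s)
normFrom : Bool → BinString → BinString
normFrom a [] = a ∷ []
normFrom a (b ∷ s) with a ≟ᵇ b
... | yes _ = normFrom b s
... | no  _ = a ∷ normFrom b s

normalize : BinString → BinString
normalize [] = []
normalize (a ∷ s) = normFrom a s

-- Block-interchange β(w,x,y,z), 1 ≤ w ≤ x < y ≤ z ≤ n:
-- s[1..w-1] s[y..z] s[x+1..y-1] s[w..x] s[z+1..n]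
blockInterchange : ℕ → ℕ → ℕ → ℕ → BinString → BinString
blockInterchange w x y z s =
  sub s 1 (w ∸ 1) ++ sub s y z ++ sub s (suc x) (y ∸ 1) ++ sub s w x
    ++ sub s (suc z) (length s)

-- Restricted prefix block-interchange β(2,2,y,z) with 3 ≤ y ≤ z ≤ n.
-- An operation on a normalized string of length n is an l-pblockInterchange
-- if the normalized result has length n - l.
Has4RestrictedPBI : BinString → Set
Has4RestrictedPBI s =
  ∃[ y ] ∃[ z ] (3 ≤ y × y ≤ z × z ≤ length s ×
    length (normalize (blockInterchange 2 2 y z s)) ≡ length s ∸ 4)

module Submission where

-- Over the alphabet {0,1} a normalized string has no choice
-- left after its first symbol: it is the alternating string a ¬a a ¬a …
-- of its length.  So a fully normalized s with |s| = 7 + m is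
--   a ¬a a ¬a a ¬a · alt(a, m+1).
-- The restricted interchange β(2,2,5,5) swaps s[2] = ¬a with s[5] = a and
-- produces  a a a ¬a ¬a ¬a · alt(a, m+1);  normalizing collapses the two
-- runs of length three and leaves the alternating string of length 3 + m,
-- i.e. exactly four symbols are removed.

open import Defs
open import Data.Bool using (Bool; true; false; not)
open import Data.Bool.Properties using (not-involutive; ¬-not)
open import Data.Nat using (ℕ; zero; suc; _+_; _∸_; _≤_; s≤s; z≤n)
open import Data.Nat.Properties using (≤-refl; m≤m+n; m≤n⇒∃[o]m+o≡n)
open import Data.List using ([]; _∷_; length)
open import Data.List.Properties using (take-all)
open import Data.Product using (_,_)
open import Relation.Binary.PropositionalEquality
  using (_≡_; _≢_; refl; sym; cong; subst; ≢-sym; module ≡-Reasoning)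

alternating : Bool → ℕ → BinString
alternating a zero    = []
alternating a (suc n) = a ∷ alternating (not a) n

length-alternating : ∀ a n → length (alternating a n) ≡ n
length-alternating a zero    = refl
length-alternating a (suc n) = cong suc (length-alternating (not a) n)

alternating-period : ∀ a n → alternating a (suc (suc n)) ≡ a ∷ not a ∷ alternating a n
alternating-period a n = cong (λ b → a ∷ not a ∷ alternating b n) (not-involutive a)

normalized⇒alternating : ∀ {a s} → Normalized (a ∷ s) → a ∷ s ≡ alternating a (suc (length s))
normalized⇒alternating {s = []} _ = refl
normalized⇒alternating {a} {b ∷ t} (norm-∷ a≢b rest) with ¬-not (≢-sym a≢b)
... | refl = cong (a ∷_) (normalized⇒alternating rest)

normFrom-repeat : ∀ a s → normFrom a (a ∷ s) ≡ normFrom a s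
normFrom-repeat true  s = refl
normFrom-repeat false s = refl

normFrom-change : ∀ {a b} s → b ≢ a → normFrom a (b ∷ s) ≡ a ∷ normFrom b s
normFrom-change {true}  {true}  s b≢a with () ← b≢a refl
normFrom-change {true}  {false} s _   = refl
normFrom-change {false} {true}  s _   = refl
normFrom-change {false} {false} s b≢a with () ← b≢a refl

a≢not-a : ∀ a → a ≢ not a
a≢not-a true  ()
a≢not-a false ()

normFrom-alternating : ∀ a n → normFrom a (alternating (not a) n) ≡ alternating a (suc n)
normFrom-alternating a zero    = refl
normFrom-alternating a (suc n) = begin
  normFrom a (not a ∷ alternating (not (not a)) n)  ≡⟨ normFrom-change _ (≢-sym (a≢not-a a)) ⟩
  a ∷ normFrom (not a) (alternating (not (not a)) n) ≡⟨ cong (a ∷_) (normFrom-alternating (not a) n) ⟩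
  alternating a (suc (suc n))                        ∎
  where open ≡-Reasoning

swap-2-5 : ∀ x₁ x₂ x₃ x₄ x₅ r →
  blockInterchange 2 2 5 5 (x₁ ∷ x₂ ∷ x₃ ∷ x₄ ∷ x₅ ∷ r) ≡ x₁ ∷ x₅ ∷ x₃ ∷ x₄ ∷ x₂ ∷ r
swap-2-5 x₁ x₂ x₃ x₄ x₅ r =
  cong (λ t → x₁ ∷ x₅ ∷ x₃ ∷ x₄ ∷ x₂ ∷ t) (take-all (length r) r ≤-refl)

-- On the alternating string of length 7 + m, β(2,2,5,5) creates two runs of
-- length three, whose normal form is the alternating string of length 3 + m.
interchange-normal-form : ∀ a m →
  normalize (blockInterchange 2 2 5 5 (alternating a (7 + m))) ≡ alternating a (3 + m)
interchange-normal-form a m = begin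
  normalize (blockInterchange 2 2 5 5 (alternating a (7 + m)))
    ≡⟨ cong (λ t → normalize (blockInterchange 2 2 5 5 t)) unfold ⟩
  normalize (blockInterchange 2 2 5 5 (a ∷ ā ∷ a ∷ ā ∷ a ∷ ā ∷ tail))
    ≡⟨ cong normalize (swap-2-5 a ā a ā a (ā ∷ tail)) ⟩
  normFrom a (a ∷ a ∷ ā ∷ ā ∷ ā ∷ tail)
    ≡⟨ normFrom-repeat a _ ⟩
  normFrom a (a ∷ ā ∷ ā ∷ ā ∷ tail)
    ≡⟨ normFrom-repeat a _ ⟩
  normFrom a (ā ∷ ā ∷ ā ∷ tail)
    ≡⟨ normFrom-change _ (≢-sym (a≢not-a a)) ⟩
  a ∷ normFrom ā (ā ∷ ā ∷ tail)
    ≡⟨ cong (a ∷_) (normFrom-repeat ā _) ⟩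
  a ∷ normFrom ā (ā ∷ tail)
    ≡⟨ cong (a ∷_) (normFrom-repeat ā _) ⟩
  a ∷ normFrom ā tail
    ≡⟨ cong (a ∷_) (normFrom-change _ (a≢not-a a)) ⟩
  a ∷ ā ∷ normFrom a (alternating ā m)
    ≡⟨ cong (λ t → a ∷ ā ∷ t) (normFrom-alternating a m) ⟩
  a ∷ ā ∷ alternating a (suc m)
    ≡⟨ sym (alternating-period a (suc m)) ⟩
  alternating a (3 + m) ∎
  where
  open ≡-Reasoning
  ā : Bool
  ā = not a
  tail : BinString
  tail = a ∷ alternating ā m
  unfold : alternating a (7 + m) ≡ a ∷ ā ∷ a ∷ ā ∷ a ∷ ā ∷ tail
  unfold = begin
    alternating a (7 + m)                         ≡⟨ alternating-period a (5 + m) ⟩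
    a ∷ ā ∷ alternating a (5 + m)                 ≡⟨ cong (λ t → a ∷ ā ∷ t) (alternating-period a (3 + m)) ⟩
    a ∷ ā ∷ a ∷ ā ∷ alternating a (3 + m)         ≡⟨ cong (λ t → a ∷ ā ∷ a ∷ ā ∷ t) (alternating-period a (1 + m)) ⟩
    a ∷ ā ∷ a ∷ ā ∷ a ∷ ā ∷ tail                  ∎

alternating-has-4PBI : ∀ a m → Has4RestrictedPBI (alternating a (7 + m))
alternating-has-4PBI a m =
  5 , 5 , s≤s (s≤s (s≤s z≤n)) , ≤-refl , five≤length , shrinks-by-4
  where
  open ≡-Reasoning
  five≤length : 5 ≤ length (alternating a (7 + m))
  five≤length = subst (5 ≤_) (sym (length-alternating a (7 + m))) (m≤m+n 5 (2 + m))
  shrinks-by-4 : length (normalize (blockInterchange 2 2 5 5 (alternating a (7 + m))))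
                 ≡ length (alternating a (7 + m)) ∸ 4
  shrinks-by-4 = begin
    length (normalize (blockInterchange 2 2 5 5 (alternating a (7 + m))))
      ≡⟨ cong length (interchange-normal-form a m) ⟩
    length (alternating a (3 + m))        ≡⟨ length-alternating a (3 + m) ⟩
    (7 + m) ∸ 4                           ≡⟨ cong (_∸ 4) (sym (length-alternating a (7 + m))) ⟩
    length (alternating a (7 + m)) ∸ 4    ∎

lemma3 : ∀ (n : ℕ) (s : BinString) → length s ≡ n → 7 ≤ n → FullyNormalized s →
    Has4RestrictedPBI s
lemma3 n (a ∷ t) refl 7≤n (normalized , _) with m≤n⇒∃[o]m+o≡n 7≤n
... | m , 7+m≡n = subst Has4RestrictedPBI (sym s≡alternating) (alternating-has-4PBI a m)
  where
  s≡alternating : a ∷ t ≡ alternating a (7 + m)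
  s≡alternating = subst (λ k → a ∷ t ≡ alternating a k) (sym 7+m≡n) (normalized⇒alternating normalized)
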